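{- For all $\lambda\mu$-objects, writing $\eta(o)\in\mathbb{N}\cup\{\infty\}$ for the supremum of the lengths of reduction sequences starting at $o$, and $\vec v$ for a (possibly empty) sequence of terms $v_1,\dots,v_m$ with $t\,\vec v=t\,v_1\cdots v_m$: (1) $\eta(x\,t_1\cdots t_n)=\sum_{i=1}^n\eta(t_i)$; (2) $\eta(\lambda x.t)=\eta(t)$; (3) $\eta(\mu\alpha.c)=\eta(c)$; (4) $\eta([\alpha]t)=\eta(t)$; (5) $\eta((\lambda x.t)u\,\vec v)=\eta(t\{x/u\}\,\vec v)+1$ if $x\in\mathrm{fv}(t)$; (6) $\eta((\lambda x.t)u\,\vec v)=\eta(u)+\eta(t\,\vec v)+1$ if $x\notin\mathrm{fv}(t)$; (7) $\eta((\mu\alpha.c)u\,\vec v)=\eta((\mu\alpha.c\{\alpha/\!\!/u\})\,\vec v)+1$ if $\alpha\in\mathrm{fn}(c)$; (8) $\eta((\mu\alpha.c)u\,\vec v)=\eta(u)+\eta((\mu\alpha.c)\,\vec v)+1$ if $\alpha\notin\mathrm{fn}(c)$.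
   Context: The $\lambda\mu$-calculus: terms $t,u::=x\mid\lambda x.t\mid t\,u\mid\mu\alpha.c$, commands $c::=[\alpha]t$, objects $o::=t\mid c$ ($x$ variables, $\alpha$ names); $\lambda x$ binds $x$, $\mu\alpha$ binds $\alpha$; $\mathrm{fv}$, $\mathrm{fn}$ free variables/names ($\mathrm{fn}([\alpha]t)=\mathrm{fn}(t)\cup\{\alpha\}$); objects up to renaming of bound symbols. $o\{x/u\}$: capture-avoiding substitution. Replacement $o\{\alpha/\!\!/u\}$: $x\{\alpha/\!\!/u\}=x$, homomorphic on abstraction, application and $\mu\gamma$, $([\gamma]t)\{\alpha/\!\!/u\}=[\gamma](t\{\alpha/\!\!/u\})$ for $\gamma\neq\alpha$, $([\alpha]t)\{\alpha/\!\!/u\}=[\alpha]((t\{\alpha/\!\!/u\})\,u)$. Reduction $\to$ is the closure under all contexts of $(\lambda x.t)u\to t\{x/u\}$ and $(\mu\alpha.c)u\to\mu\alpha.(c\{\alpha/\!\!/u\})$. -}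

module Defs where

open import Data.Nat using (ℕ; zero; suc; pred; _+_; _≤_; _<ᵇ_; _≡ᵇ_)
open import Data.Bool using (Bool; true; false; if_then_else_; T; _∨_)
open import Data.List using (List; []; _∷_; foldl)
open import Data.Product using (Σ; ∃; _×_; _,_)
open import Data.Empty using (⊥)

-- λμ-calculus syntax, with de Bruijn indices (objects are therefore
-- identified up to renaming of bound symbols).  Variables and names
-- live in two separate index spaces: λ binds variable index 0, μ binds
-- name index 0.

mutual
  data Term : Set where
    var : ℕ → Term
    lam : Term → Term
    app : Term → Term → Term
    mu  : Cmd → Term

  data Cmd : Set where
    cmd : ℕ → Term → Cmd

data Obj : Set where
  term : Term → Obj
  com  : Cmd → Obj

_··_ : Term → List Term → Term
t ·· vs = foldl app t vs

mutual
  shiftV : ℕ → Term → Term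
  shiftV c (var x)   = if x <ᵇ c then var x else var (suc x)
  shiftV c (lam t)   = lam (shiftV (suc c) t)
  shiftV c (app t u) = app (shiftV c t) (shiftV c u)
  shiftV c (mu k)    = mu (shiftVc c k)

  shiftVc : ℕ → Cmd → Cmd
  shiftVc c (cmd β t) = cmd β (shiftV c t)

mutual
  shiftN : ℕ → Term → Term
  shiftN c (var x)   = var x
  shiftN c (lam t)   = lam (shiftN c t)
  shiftN c (app t u) = app (shiftN c t) (shiftN c u)
  shiftN c (mu k)    = mu (shiftNc (suc c) k)

  shiftNc : ℕ → Cmd → Cmd
  shiftNc c (cmd β t) = cmd (if β <ᵇ c then β else suc β) (shiftN c t)

-- Capture-avoiding substitution  t{k/u}  (the variable k is removed,
-- variables above k are lowered since the binder disappears)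

mutual
  substV : ℕ → Term → Term → Term
  substV k u (var x)   = if x ≡ᵇ k then u else (if x <ᵇ k then var x else var (pred x))
  substV k u (lam t)   = lam (substV (suc k) (shiftV 0 u) t)
  substV k u (app t s) = app (substV k u t) (substV k u s)
  substV k u (mu c)    = mu (substVc k (shiftN 0 u) c)

  substVc : ℕ → Term → Cmd → Cmd
  substVc k u (cmd β t) = cmd β (substV k u t)

-- Replacement  o{α//u}  (α = name index k; α stays bound, so no lowering)

mutual
  repl : ℕ → Term → Term → Term
  repl k u (var x)   = var x
  repl k u (lam t)   = lam (repl k (shiftV 0 u) t)
  repl k u (app t s) = app (repl k u t) (repl k u s)
  repl k u (mu c)    = mu (replc (suc k) (shiftN 0 u) c)

  replc : ℕ → Term → Cmd → Cmd
  replc k u (cmd β t) =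
    if β ≡ᵇ k then cmd β (app (repl k u t) u) else cmd β (repl k u t)

mutual
  fvT : ℕ → Term → Bool
  fvT k (var x)   = x ≡ᵇ k
  fvT k (lam t)   = fvT (suc k) t
  fvT k (app t u) = fvT k t ∨ fvT k u
  fvT k (mu c)    = fvC k c

  fvC : ℕ → Cmd → Bool
  fvC k (cmd β t) = fvT k t

mutual
  fnT : ℕ → Term → Bool
  fnT k (var x)   = false
  fnT k (lam t)   = fnT k t
  fnT k (app t u) = fnT k t ∨ fnT k u
  fnT k (mu c)    = fnC (suc k) c

  fnC : ℕ → Cmd → Bool
  fnC k (cmd β t) = (β ≡ᵇ k) ∨ fnT k t

-- "the variable bound by the enclosing λ occurs free in t"
_∈fv_ : ℕ → Term → Set
k ∈fv t = T (fvT k t)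

-- "the name bound by the enclosing μ occurs free in c"
_∈fn_ : ℕ → Cmd → Set
k ∈fn c = T (fnC k c)

mutual
  data _⟶t_ : Term → Term → Set where
    β    : ∀ {t u} → app (lam t) u ⟶t substV 0 u t
    μ    : ∀ {c u} → app (mu c) u ⟶t mu (replc 0 (shiftN 0 u) c)
    lamξ : ∀ {t t'} → t ⟶t t' → lam t ⟶t lam t'
    appL : ∀ {t t' u} → t ⟶t t' → app t u ⟶t app t' u
    appR : ∀ {t u u'} → u ⟶t u' → app t u ⟶t app t u'
    muξ  : ∀ {c c'} → c ⟶c c' → mu c ⟶t mu c'

  data _⟶c_ : Cmd → Cmd → Set where
    cmdξ : ∀ {α t t'} → t ⟶t t' → cmd α t ⟶c cmd α t'

data _⟶_ : Obj → Obj → Set where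
  tstep : ∀ {t t'} → t ⟶t t' → term t ⟶ term t'
  cstep : ∀ {c c'} → c ⟶c c' → com c ⟶ com c'

data _⟶[_]_ : Obj → ℕ → Obj → Set where
  done : ∀ {o} → o ⟶[ 0 ] o
  step : ∀ {o o' o'' k} → o ⟶ o' → o' ⟶[ k ] o'' → o ⟶[ suc k ] o''

data ℕ∞ : Set where
  fin : ℕ → ℕ∞
  ∞   : ℕ∞

_+∞_ : ℕ∞ → ℕ∞ → ℕ∞
fin m +∞ fin n = fin (m + n)
fin m +∞ ∞     = ∞
∞     +∞ _     = ∞

sum∞ : List ℕ∞ → ℕ∞
sum∞ []       = fin 0
sum∞ (e ∷ es) = e +∞ sum∞ es

IsSup : (ℕ → Set) → ℕ∞ → Set
IsSup P (fin n) = (∀ k → P k → k ≤ n) × (∀ m → (∀ k → P k → k ≤ m) → n ≤ m)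
IsSup P ∞       = ∀ m → (∀ k → P k → k ≤ m) → ⊥

η_≡_ : Obj → ℕ∞ → Set
η o ≡ e = IsSup (λ k → ∃ λ o' → o ⟶[ k ] o') e

data ηAll : List Term → List ℕ∞ → Set where
  []  : ηAll [] []
  _∷_ : ∀ {t ts e es} → η term t ≡ e → ηAll ts es → ηAll (t ∷ ts) (e ∷ es)

-- Items (2)–(4) hold because reductions of λx.t, μα.c and [α]t are exactly
-- the reductions of their body, and (1) because a reduction of x t₁ ⋯ tₙ
-- interleaves independent reductions of the tᵢ.  Items (5)–(8) concern a
-- head redex r = R u v⃗ (R = λx.t or μα.c) with contractum w.  Every
-- reduction of r is decomposed (`decomp`) into steps inside R, u and v⃗,
-- optionally followed by the head contraction and a reduction of the
-- result; all these steps are replayed in w, where the steps of u are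
-- replayed at least once when the bound symbol occurs (substitution and
-- replacement are compatible with reduction).  This gives the upper bounds;
-- the lower bounds contract the head redex first, resp. reduce u first and
-- then contract, erasing u.  Suprema in ℕ ∪ {∞} are handled abstractly by
-- `IsSup-sum`, which computes sup Q = sup P₁ + sup P₂ + d from such bounds.

module Submission where

open import Defs
open import Data.Bool using (true; false; if_then_else_; T; _∨_)
open import Data.Bool.Properties using (∨-conicalˡ; ∨-conicalʳ)
open import Data.Empty using (⊥-elim)
open import Data.List using (List; []; _∷_)
open import Data.Nat
open import Data.Nat.Properties
open import Data.Nat.Tactic.RingSolver using (solve-∀)
open import Data.Product using (Σ; _×_; _,_; proj₁; proj₂)
open import Data.Sum using (_⊎_; inj₁; inj₂)
open import Relation.Binary using (tri<; tri≈; tri>)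
open import Relation.Binary.PropositionalEquality
open import Relation.Nullary using (¬_; yes; no)

<ᵇ-true : ∀ {x c} → x < c → (x <ᵇ c) ≡ true
<ᵇ-true {zero} {suc c} p = refl
<ᵇ-true {suc x} {suc c} (s≤s p) = <ᵇ-true p

<ᵇ-false : ∀ {x c} → c ≤ x → (x <ᵇ c) ≡ false
<ᵇ-false {x} {zero} p = refl
<ᵇ-false {suc x} {suc c} (s≤s p) = <ᵇ-false p

≡ᵇ-refl : ∀ x → (x ≡ᵇ x) ≡ true
≡ᵇ-refl zero = refl
≡ᵇ-refl (suc x) = ≡ᵇ-refl x

≡ᵇ-false : ∀ {x k} → x ≢ k → (x ≡ᵇ k) ≡ false
≡ᵇ-false {zero} {zero} p = ⊥-elim (p refl)
≡ᵇ-false {zero} {suc k} p = refl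
≡ᵇ-false {suc x} {zero} p = refl
≡ᵇ-false {suc x} {suc k} p = ≡ᵇ-false (λ e → p (cong suc e))

≡ᵇ-sound : ∀ {x k} → (x ≡ᵇ k) ≡ true → x ≡ k
≡ᵇ-sound {x} {k} e = ≡ᵇ⇒≡ x k (subst T (sym e) _)

data LtView (x c : ℕ) : Set where
  below : x < c → (x <ᵇ c) ≡ true → LtView x c
  above : c ≤ x → (x <ᵇ c) ≡ false → LtView x c

lt-view : ∀ x c → LtView x c
lt-view x c with x <? c
... | yes p = below p (<ᵇ-true p)
... | no p = above (≮⇒≥ p) (<ᵇ-false (≮⇒≥ p))

data CmpView (x k : ℕ) : Set where
  less : x < k → (x <ᵇ k) ≡ true → (x ≡ᵇ k) ≡ false → CmpView x k
  same : x ≡ k → CmpView x k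
  greater : k < x → (x <ᵇ k) ≡ false → (x ≡ᵇ k) ≡ false → CmpView x k

cmp-view : ∀ x k → CmpView x k
cmp-view x k with <-cmp x k
... | tri< a _ _ = less a (<ᵇ-true a) (≡ᵇ-false (<⇒≢ a))
... | tri≈ _ b _ = same b
... | tri> _ _ c = greater c (<ᵇ-false (<⇒≤ c)) (≡ᵇ-false (≢-sym (<⇒≢ c)))

shiftName : ℕ → ℕ → ℕ
shiftName c b = if b <ᵇ c then b else suc b

shiftV-var : ∀ c x → shiftV c (var x) ≡ var (shiftName c x)
shiftV-var c x with x <ᵇ c
... | true = refl
... | false = refl

shiftName-shiftName : ∀ c d x → c ≤ d →
  shiftName (suc d) (shiftName c x) ≡ shiftName c (shiftName d x)
shiftName-shiftName c d x p with lt-view x c | lt-view x d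
... | below a e1 | below b e2 rewrite e1 | e2 | <ᵇ-true (m<n⇒m<1+n b) | e1 = refl
... | below a e1 | above b e2 = ⊥-elim (<⇒≱ (<-≤-trans a p) b)
... | above a e1 | below b e2 rewrite e1 | e2 | e1 = refl
... | above a e1 | above b e2 rewrite e1 | e2 | <ᵇ-false (≤-trans a (n≤1+n x)) = refl

shiftV-shiftV : ∀ c d t → c ≤ d → shiftV (suc d) (shiftV c t) ≡ shiftV c (shiftV d t)
shiftV-shiftV c d (var x) p = begin
  shiftV (suc d) (shiftV c (var x))          ≡⟨ cong (shiftV (suc d)) (shiftV-var c x) ⟩
  shiftV (suc d) (var (shiftName c x))       ≡⟨ shiftV-var (suc d) (shiftName c x) ⟩
  var (shiftName (suc d) (shiftName c x))    ≡⟨ cong var (shiftName-shiftName c d x p) ⟩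
  var (shiftName c (shiftName d x))          ≡⟨ shiftV-var c (shiftName d x) ⟨
  shiftV c (var (shiftName d x))             ≡⟨ cong (shiftV c) (shiftV-var d x) ⟨
  shiftV c (shiftV d (var x))                ∎
  where open ≡-Reasoning
shiftV-shiftV c d (lam t) p = cong lam (shiftV-shiftV (suc c) (suc d) t (s≤s p))
shiftV-shiftV c d (app t u) p = cong₂ app (shiftV-shiftV c d t p) (shiftV-shiftV c d u p)
shiftV-shiftV c d (mu (cmd b t)) p = cong (λ z → mu (cmd b z)) (shiftV-shiftV c d t p)

shiftN-shiftN : ∀ c d t → c ≤ d → shiftN (suc d) (shiftN c t) ≡ shiftN c (shiftN d t)
shiftN-shiftN c d (var x) p = refl
shiftN-shiftN c d (lam t) p = cong lam (shiftN-shiftN c d t p)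
shiftN-shiftN c d (app t u) p = cong₂ app (shiftN-shiftN c d t p) (shiftN-shiftN c d u p)
shiftN-shiftN c d (mu (cmd b t)) p =
  cong₂ (λ x y → mu (cmd x y))
    (shiftName-shiftName (suc c) (suc d) b (s≤s p))
    (shiftN-shiftN (suc c) (suc d) t (s≤s p))

shiftV-shiftN : ∀ c d t → shiftV c (shiftN d t) ≡ shiftN d (shiftV c t)
shiftV-shiftN c d (var x) with lt-view x c
... | below a e rewrite e = refl
... | above a e rewrite e = refl
shiftV-shiftN c d (lam t) = cong lam (shiftV-shiftN (suc c) d t)
shiftV-shiftN c d (app t u) = cong₂ app (shiftV-shiftN c d t) (shiftV-shiftN c d u)
shiftV-shiftN c d (mu (cmd b t)) = cong (λ z → mu (cmd _ z)) (shiftV-shiftN c (suc d) t)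

shiftV-substV-≤ : ∀ c k u w → c ≤ k →
  shiftV c (substV k u w) ≡ substV (suc k) (shiftV c u) (shiftV c w)
shiftV-substV-≤ c k u (var x) p with cmp-view x k
shiftV-substV-≤ c k u (var x) p | less a e1 e2 with lt-view x c
... | below b e3 rewrite e2 | e1 | e3 | ≡ᵇ-false (<⇒≢ (m<n⇒m<1+n a)) | <ᵇ-true (m<n⇒m<1+n a) = refl
... | above b e3 rewrite e2 | e1 | e3 | e2 | e1 = refl
shiftV-substV-≤ c k u (var x) p | same refl rewrite ≡ᵇ-refl x | <ᵇ-false p | ≡ᵇ-refl x = refl
shiftV-substV-≤ c k u (var (suc y)) p | greater (s≤s a) e1 e2
  rewrite e2 | e1 | <ᵇ-false (≤-trans p a) | <ᵇ-false (≤-trans p (≤-trans a (n≤1+n y))) | e2 | e1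
  = refl
shiftV-substV-≤ c k u (lam t) p =
  cong lam
    (trans (shiftV-substV-≤ (suc c) (suc k) (shiftV 0 u) t (s≤s p))
       (cong (λ z → substV (suc (suc k)) z (shiftV (suc c) t)) (shiftV-shiftV 0 c u z≤n)))
shiftV-substV-≤ c k u (app t s) p = cong₂ app (shiftV-substV-≤ c k u t p) (shiftV-substV-≤ c k u s p)
shiftV-substV-≤ c k u (mu (cmd b t)) p =
  cong (λ z → mu (cmd b z))
    (trans (shiftV-substV-≤ c k (shiftN 0 u) t p)
       (cong (λ z → substV (suc k) z (shiftV c t)) (shiftV-shiftN c 0 u)))

shiftV-substV-≥ : ∀ c k u w → k ≤ c →
  shiftV c (substV k u w) ≡ substV k (shiftV c u) (shiftV (suc c) w)
shiftV-substV-≥ c k u (var x) p with cmp-view x k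
... | less a e1 e2
  rewrite e2 | e1 | <ᵇ-true (<-≤-trans a p) | <ᵇ-true (<-≤-trans a (≤-trans p (n≤1+n c))) | e2 | e1
  = refl
... | same refl rewrite ≡ᵇ-refl x | <ᵇ-true (s≤s p) | ≡ᵇ-refl x = refl
shiftV-substV-≥ c k u (var (suc y)) p | greater (s≤s a) e1 e2 with lt-view y c
... | below b e3 rewrite e2 | e1 | e3 | e2 | e1 = refl
... | above b e3
  rewrite e2 | e1 | e3 | ≡ᵇ-false {suc (suc y)} {k} (≢-sym (<⇒≢ (s≤s (≤-trans a (n≤1+n y)))))
        | <ᵇ-false {suc (suc y)} {k} (≤-trans a (≤-trans (n≤1+n y) (n≤1+n (suc y))))
  = refl
shiftV-substV-≥ c k u (lam t) p =
  cong lam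
    (trans (shiftV-substV-≥ (suc c) (suc k) (shiftV 0 u) t (s≤s p))
       (cong (λ z → substV (suc k) z (shiftV (suc (suc c)) t)) (shiftV-shiftV 0 c u z≤n)))
shiftV-substV-≥ c k u (app t s) p = cong₂ app (shiftV-substV-≥ c k u t p) (shiftV-substV-≥ c k u s p)
shiftV-substV-≥ c k u (mu (cmd b t)) p =
  cong (λ z → mu (cmd b z))
    (trans (shiftV-substV-≥ c k (shiftN 0 u) t p)
       (cong (λ z → substV k z (shiftV (suc c) t)) (shiftV-shiftN c 0 u)))

shiftN-substV : ∀ c k u w → shiftN c (substV k u w) ≡ substV k (shiftN c u) (shiftN c w)
shiftN-substV c k u (var x) with x ≡ᵇ k
... | true = refl
... | false with x <ᵇ k
... | true = refl
... | false = refl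
shiftN-substV c k u (lam t) =
  cong lam
    (trans (shiftN-substV c (suc k) (shiftV 0 u) t)
       (cong (λ z → substV (suc k) z (shiftN c t)) (sym (shiftV-shiftN 0 c u))))
shiftN-substV c k u (app t s) = cong₂ app (shiftN-substV c k u t) (shiftN-substV c k u s)
shiftN-substV c k u (mu (cmd b t)) =
  cong (λ z → mu (cmd _ z))
    (trans (shiftN-substV (suc c) k (shiftN 0 u) t)
       (cong (λ z → substV k z (shiftN (suc c) t)) (shiftN-shiftN 0 c u z≤n)))

substV-shiftV-self : ∀ x w → substV x w (shiftV x (var x)) ≡ var x
substV-shiftV-self x w
  rewrite <ᵇ-false (≤-refl {x}) | ≡ᵇ-false (λ e → 1+n≢n {x} e) | <ᵇ-false (n≤1+n x)
  = refl

substV-shiftV : ∀ j w t → substV j w (shiftV j t) ≡ t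
substV-shiftV j w (var x) with cmp-view x j
... | less a e1 e2 rewrite e1 | e2 | e1 = refl
... | same refl = substV-shiftV-self x w
... | greater c e1 e2
  rewrite e1 | ≡ᵇ-false (≢-sym (<⇒≢ (m<n⇒m<1+n c))) | <ᵇ-false (≤-trans (<⇒≤ c) (n≤1+n x))
  = refl
substV-shiftV j w (lam t) = cong lam (substV-shiftV (suc j) (shiftV 0 w) t)
substV-shiftV j w (app t s) = cong₂ app (substV-shiftV j w t) (substV-shiftV j w s)
substV-shiftV j w (mu (cmd b t)) = cong (λ z → mu (cmd b z)) (substV-shiftV j (shiftN 0 w) t)

substV-substV : ∀ j k u w s → j ≤ k →
  substV k u (substV j w s) ≡ substV j (substV k u w) (substV (suc k) (shiftV j u) s)
substV-substV j k u w (var x) p with cmp-view x j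
... | less a e1 e2
  rewrite e2 | e1 | ≡ᵇ-false (<⇒≢ (<-≤-trans a p)) | <ᵇ-true (<-≤-trans a p)
        | ≡ᵇ-false (<⇒≢ (<-≤-trans a (≤-trans p (n≤1+n k))))
        | <ᵇ-true (<-≤-trans a (≤-trans p (n≤1+n k))) | e2 | e1
  = refl
... | same refl rewrite ≡ᵇ-refl x | ≡ᵇ-false (<⇒≢ (s≤s p)) | <ᵇ-true (s≤s p) | ≡ᵇ-refl x = refl
substV-substV j k u w (var (suc y)) p | greater (s≤s a) e1 e2 with cmp-view y k
... | less b f1 f2 rewrite e2 | e1 | f2 | f1 | e2 | e1 = refl
... | same refl rewrite e2 | e1 | ≡ᵇ-refl y = sym (substV-shiftV j (substV y u w) u)
substV-substV j k u w (var (suc (suc z))) p | greater (s≤s a) e1 e2 | greater (s≤s b) f1 f2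
  rewrite e2 | e1 | f2 | f1 | ≡ᵇ-false {suc z} {j} (≢-sym (<⇒≢ (s≤s (≤-trans p b))))
        | <ᵇ-false {suc z} {j} (≤-trans p (≤-trans b (n≤1+n z)))
  = refl
substV-substV j k u w (lam t) p =
  cong lam
    (trans (substV-substV (suc j) (suc k) (shiftV 0 u) (shiftV 0 w) t (s≤s p))
       (cong₂ (λ a b → substV (suc j) a (substV (suc (suc k)) b t))
          (sym (shiftV-substV-≤ 0 k u w z≤n))
          (shiftV-shiftV 0 j u z≤n)))
substV-substV j k u w (app t s) p = cong₂ app (substV-substV j k u w t p) (substV-substV j k u w s p)
substV-substV j k u w (mu (cmd b t)) p =
  cong (λ z → mu (cmd b z))
    (trans (substV-substV j k (shiftN 0 u) (shiftN 0 w) t p)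
       (cong₂ (λ a c → substV j a (substV (suc k) c t))
          (sym (shiftN-substV 0 k u w))
          (shiftV-shiftN j 0 u)))

shiftV-repl : ∀ c k U s → shiftV c (repl k U s) ≡ repl k (shiftV c U) (shiftV c s)
shiftV-replc : ∀ c k U b t →
  shiftVc c (replc k U (cmd b t)) ≡ replc k (shiftV c U) (cmd b (shiftV c t))
shiftV-repl c k U (var x) with lt-view x c
... | below a e rewrite e = refl
... | above a e rewrite e = refl
shiftV-repl c k U (lam t) =
  cong lam
    (trans (shiftV-repl (suc c) k (shiftV 0 U) t)
       (cong (λ z → repl k z (shiftV (suc c) t)) (shiftV-shiftV 0 c U z≤n)))
shiftV-repl c k U (app t s) = cong₂ app (shiftV-repl c k U t) (shiftV-repl c k U s)
shiftV-repl c k U (mu (cmd b t)) =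
  cong mu
    (trans (shiftV-replc c (suc k) (shiftN 0 U) b t)
       (cong (λ z → replc (suc k) z (cmd b (shiftV c t))) (shiftV-shiftN c 0 U)))
shiftV-replc c k U b t with b ≡ᵇ k
... | true = cong (λ z → cmd b (app z (shiftV c U))) (shiftV-repl c k U t)
... | false = cong (cmd b) (shiftV-repl c k U t)

shiftN-repl-≤ : ∀ c k U s → c ≤ k → shiftN c (repl k U s) ≡ repl (suc k) (shiftN c U) (shiftN c s)
shiftN-replc-≤ : ∀ c k U b t → c ≤ k →
  shiftNc c (replc k U (cmd b t)) ≡ replc (suc k) (shiftN c U) (cmd (shiftName c b) (shiftN c t))
shiftN-repl-≤ c k U (var x) p = refl
shiftN-repl-≤ c k U (lam t) p =
  cong lam
    (trans (shiftN-repl-≤ c k (shiftV 0 U) t p)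
       (cong (λ z → repl (suc k) z (shiftN c t)) (sym (shiftV-shiftN 0 c U))))
shiftN-repl-≤ c k U (app t s) p = cong₂ app (shiftN-repl-≤ c k U t p) (shiftN-repl-≤ c k U s p)
shiftN-repl-≤ c k U (mu (cmd b t)) p =
  cong mu
    (trans (shiftN-replc-≤ (suc c) (suc k) (shiftN 0 U) b t (s≤s p))
       (cong (λ z → replc (suc (suc k)) z (cmd (shiftName (suc c) b) (shiftN (suc c) t)))
          (shiftN-shiftN 0 c U z≤n)))
shiftN-replc-≤ c k U b t p with cmp-view b k
... | same refl
  rewrite ≡ᵇ-refl b | <ᵇ-false p | ≡ᵇ-refl b
  = cong (λ z → cmd (suc b) (app z (shiftN c U))) (shiftN-repl-≤ c b U t p)
... | less a e1 e2 with lt-view b c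
...    | below q f
  rewrite e2 | f | ≡ᵇ-false (<⇒≢ (<-≤-trans q (≤-trans p (n≤1+n k))))
  = cong (cmd b) (shiftN-repl-≤ c k U t p)
...    | above q f rewrite e2 | f | e2 = cong (cmd (suc b)) (shiftN-repl-≤ c k U t p)
shiftN-replc-≤ c k U b t p | greater a e1 e2
  rewrite e2 | <ᵇ-false (≤-trans p (<⇒≤ a)) | e2
  = cong (cmd (suc b)) (shiftN-repl-≤ c k U t p)

shiftN-repl-> : ∀ c k U s → k < c → shiftN c (repl k U s) ≡ repl k (shiftN c U) (shiftN c s)
shiftN-replc-> : ∀ c k U b t → k < c →
  shiftNc c (replc k U (cmd b t)) ≡ replc k (shiftN c U) (cmd (shiftName c b) (shiftN c t))
shiftN-repl-> c k U (var x) p = refl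
shiftN-repl-> c k U (lam t) p =
  cong lam
    (trans (shiftN-repl-> c k (shiftV 0 U) t p)
       (cong (λ z → repl k z (shiftN c t)) (sym (shiftV-shiftN 0 c U))))
shiftN-repl-> c k U (app t s) p = cong₂ app (shiftN-repl-> c k U t p) (shiftN-repl-> c k U s p)
shiftN-repl-> c k U (mu (cmd b t)) p =
  cong mu
    (trans (shiftN-replc-> (suc c) (suc k) (shiftN 0 U) b t (s≤s p))
       (cong (λ z → replc (suc k) z (cmd (shiftName (suc c) b) (shiftN (suc c) t)))
          (shiftN-shiftN 0 c U z≤n)))
shiftN-replc-> c k U b t p with b ≡ᵇ k in e0
... | true with ≡ᵇ-sound {b} {k} e0
...   | refl
  rewrite <ᵇ-true p | ≡ᵇ-refl b
  = cong (λ z → cmd b (app z (shiftN c U))) (shiftN-repl-> c b U t p)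
shiftN-replc-> c k U b t p | false with lt-view b c
...    | below q f rewrite f | e0 = cong (cmd b) (shiftN-repl-> c k U t p)
...    | above q f
  rewrite f | ≡ᵇ-false {suc b} {k} (≢-sym (<⇒≢ (<-≤-trans p (≤-trans q (n≤1+n b)))))
  = cong (cmd (suc b)) (shiftN-repl-> c k U t p)

repl-substV : ∀ k U j w s → repl k U (substV j w s) ≡ substV j (repl k U w) (repl k (shiftV j U) s)
replc-substV : ∀ K U j w b t →
  replc K U (cmd b (substV j w t)) ≡ substVc j (repl K U w) (replc K (shiftV j U) (cmd b t))
repl-substV k U j w (var x) with x ≡ᵇ j
... | true = refl
... | false with x <ᵇ j
... | true = refl
... | false = refl
repl-substV k U j w (lam t) =
  cong lam
    (trans (repl-substV k (shiftV 0 U) (suc j) (shiftV 0 w) t)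
       (cong₂ (λ a c → substV (suc j) a (repl k c t))
          (sym (shiftV-repl 0 k U w))
          (shiftV-shiftV 0 j U z≤n)))
repl-substV k U j w (app t s) = cong₂ app (repl-substV k U j w t) (repl-substV k U j w s)
repl-substV k U j w (mu (cmd b t)) =
  cong mu
    (trans (replc-substV (suc k) (shiftN 0 U) j (shiftN 0 w) b t)
       (cong₂ (λ a c → substVc j a (replc (suc k) c (cmd b t)))
          (sym (shiftN-repl-≤ 0 k U w z≤n))
          (shiftV-shiftN j 0 U)))
replc-substV K U j w b t with b ≡ᵇ K
... | true = cong₂ (λ x y → cmd b (app x y)) (repl-substV K U j w t) (sym (substV-shiftV j (repl K U w) U))
... | false = cong (cmd b) (repl-substV K U j w t)

repl-fresh : ∀ k U s → fnT k s ≡ false → repl k U s ≡ s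
replc-fresh : ∀ k U c → fnC k c ≡ false → replc k U c ≡ c
repl-fresh k U (var x) e = refl
repl-fresh k U (lam t) e = cong lam (repl-fresh k (shiftV 0 U) t e)
repl-fresh k U (app t s) e =
  cong₂ app (repl-fresh k U t (∨-conicalˡ _ _ e)) (repl-fresh k U s (∨-conicalʳ _ _ e))
repl-fresh k U (mu c) e = cong mu (replc-fresh (suc k) (shiftN 0 U) c e)
replc-fresh k U (cmd b t) e with b ≡ᵇ k | e
... | true | ()
... | false | e' = cong (cmd b) (repl-fresh k U t e')

fnT-shiftV : ∀ k c U → fnT k (shiftV c U) ≡ fnT k U
fnT-shiftV k c (var x) with lt-view x c
... | below a e rewrite e = refl
... | above a e rewrite e = refl
fnT-shiftV k c (lam t) = fnT-shiftV k (suc c) t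
fnT-shiftV k c (app t s) = cong₂ _∨_ (fnT-shiftV k c t) (fnT-shiftV k c s)
fnT-shiftV k c (mu (cmd b t)) = cong ((b ≡ᵇ suc k) ∨_) (fnT-shiftV (suc k) c t)

shiftName-≡ᵇ : ∀ c k b → c ≤ k → (shiftName c b ≡ᵇ suc k) ≡ (b ≡ᵇ k)
shiftName-≡ᵇ c k b p with lt-view b c
... | below a e
  rewrite e | ≡ᵇ-false {b} {suc k} (<⇒≢ (<-≤-trans a (≤-trans p (n≤1+n k))))
        | ≡ᵇ-false {b} {k} (<⇒≢ (<-≤-trans a p))
  = refl
... | above a e rewrite e = refl

fnT-shiftN : ∀ c k U → c ≤ k → fnT (suc k) (shiftN c U) ≡ fnT k U
fnT-shiftN c k (var x) p = refl
fnT-shiftN c k (lam t) p = fnT-shiftN c k t p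
fnT-shiftN c k (app t s) p = cong₂ _∨_ (fnT-shiftN c k t p) (fnT-shiftN c k s p)
fnT-shiftN c k (mu (cmd b t)) p =
  cong₂ _∨_ (shiftName-≡ᵇ (suc c) (suc k) b (s≤s p)) (fnT-shiftN (suc c) (suc k) t (s≤s p))

shiftName-≢ : ∀ c b → (shiftName c b ≡ᵇ c) ≡ false
shiftName-≢ c b with lt-view b c
... | below a e rewrite e = ≡ᵇ-false (<⇒≢ a)
... | above a e rewrite e = ≡ᵇ-false (≢-sym (<⇒≢ (s≤s a)))

fnT-shiftN-self : ∀ c U → fnT c (shiftN c U) ≡ false
fnT-shiftN-self c (var x) = refl
fnT-shiftN-self c (lam t) = fnT-shiftN-self c t
fnT-shiftN-self c (app t s) rewrite fnT-shiftN-self c t | fnT-shiftN-self c s = refl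
fnT-shiftN-self c (mu (cmd b t)) rewrite shiftName-≢ (suc c) b | fnT-shiftN-self (suc c) t = refl

repl-repl : ∀ J K U W s → J ≢ K →
  fnT J U ≡ false → repl K U (repl J W s) ≡ repl J (repl K U W) (repl K U s)
replc-repl : ∀ J K U W b t → J ≢ K →
  fnT J U ≡ false → replc K U (replc J W (cmd b t)) ≡ replc J (repl K U W) (replc K U (cmd b t))
repl-repl J K U W (var x) n f = refl
repl-repl J K U W (lam t) n f =
  cong lam
    (trans (repl-repl J K (shiftV 0 U) (shiftV 0 W) t n (trans (fnT-shiftV J 0 U) f))
       (cong (λ z → repl J z (repl K (shiftV 0 U) t)) (sym (shiftV-repl 0 K U W))))
repl-repl J K U W (app t s) n f = cong₂ app (repl-repl J K U W t n f) (repl-repl J K U W s n f)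
repl-repl J K U W (mu (cmd b t)) n f =
  cong mu
    (trans
       (replc-repl (suc J)
          (suc K)
          (shiftN 0 U)
          (shiftN 0 W)
          b t (λ e → n (suc-injective e))
          (trans (fnT-shiftN 0 J U z≤n) f))
       (cong (λ z → replc (suc J) z (replc (suc K) (shiftN 0 U) (cmd b t)))
          (sym (shiftN-repl-≤ 0 K U W z≤n))))
replc-repl J K U W b t n f with b ≡ᵇ J in eJ
... | true with ≡ᵇ-sound {b} {J} eJ
...   | refl
  rewrite ≡ᵇ-false {b} {K} n | eJ
  = cong (λ z → cmd b (app z (repl K U W))) (repl-repl b K U W t n f)
replc-repl J K U W b t n f | false with b ≡ᵇ K
... | true
  rewrite eJ
  = cong₂ (λ x y → cmd b (app x y)) (repl-repl J K U W t n f) (sym (repl-fresh J (repl K U W) U f))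
... | false rewrite eJ = cong (cmd b) (repl-repl J K U W t n f)

substV-repl : ∀ k U j W s →
  fnT j U ≡ false → substV k U (repl j W s) ≡ repl j (substV k U W) (substV k U s)
substVc-replc : ∀ k U J W b t →
  fnT J U ≡ false → substVc k U (replc J W (cmd b t)) ≡ replc J (substV k U W) (cmd b (substV k U t))
substV-repl k U j W (var x) f with x ≡ᵇ k
... | true = sym (repl-fresh j (substV k U W) U f)
... | false with x <ᵇ k
... | true = refl
... | false = refl
substV-repl k U j W (lam t) f =
  cong lam
    (trans (substV-repl (suc k) (shiftV 0 U) j (shiftV 0 W) t (trans (fnT-shiftV j 0 U) f))
       (cong (λ z → repl j z (substV (suc k) (shiftV 0 U) t)) (sym (shiftV-substV-≤ 0 k U W z≤n))))
substV-repl k U j W (app t s) f = cong₂ app (substV-repl k U j W t f) (substV-repl k U j W s f)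
substV-repl k U j W (mu (cmd b t)) f =
  cong mu
    (trans (substVc-replc k (shiftN 0 U) (suc j) (shiftN 0 W) b t (trans (fnT-shiftN 0 j U z≤n) f))
       (cong (λ z → replc (suc j) z (cmd b (substV k (shiftN 0 U) t))) (sym (shiftN-substV 0 k U W))))
substVc-replc k U J W b t f with b ≡ᵇ J
... | true = cong (λ z → cmd b (app z (substV k U W))) (substV-repl k U J W t f)
... | false = cong (cmd b) (substV-repl k U J W t f)

substV-fresh : ∀ k u u' t → fvT k t ≡ false → substV k u t ≡ substV k u' t
substV-fresh k u u' (var x) e with x ≡ᵇ k | e
... | true | ()
... | false | _ = refl
substV-fresh k u u' (lam t) e = cong lam (substV-fresh (suc k) (shiftV 0 u) (shiftV 0 u') t e)
substV-fresh k u u' (app t s) e =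
  cong₂ app (substV-fresh k u u' t (∨-conicalˡ _ _ e))
    (substV-fresh k u u' s (∨-conicalʳ _ _ e))
substV-fresh k u u' (mu (cmd b t)) e =
  cong (λ z → mu (cmd b z)) (substV-fresh k (shiftN 0 u) (shiftN 0 u') t e)

cast⟶ : ∀ {a b b'} → a ⟶t b → b ≡ b' → a ⟶t b'
cast⟶ s refl = s

⟶-shiftV : ∀ c {t t'} → t ⟶t t' → shiftV c t ⟶t shiftV c t'
⟶-shiftV c (β {t} {u}) = cast⟶ β (sym (shiftV-substV-≥ c 0 u t z≤n))
⟶-shiftV c (μ {cmd b t} {u}) =
  cast⟶ μ
    (sym
       (trans (cong mu (shiftV-replc c 0 (shiftN 0 u) b t))
          (cong (λ z → mu (replc 0 z (cmd b (shiftV c t)))) (shiftV-shiftN c 0 u))))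
⟶-shiftV c (lamξ s) = lamξ (⟶-shiftV (suc c) s)
⟶-shiftV c (appL s) = appL (⟶-shiftV c s)
⟶-shiftV c (appR s) = appR (⟶-shiftV c s)
⟶-shiftV c (muξ (cmdξ s)) = muξ (cmdξ (⟶-shiftV c s))

⟶-shiftN : ∀ c {t t'} → t ⟶t t' → shiftN c t ⟶t shiftN c t'
⟶-shiftN c (β {t} {u}) = cast⟶ β (sym (shiftN-substV c 0 u t))
⟶-shiftN c (μ {cmd b t} {u}) =
  cast⟶ μ
    (sym
       (trans (cong mu (shiftN-replc-> (suc c) 0 (shiftN 0 u) b t (s≤s z≤n)))
          (cong (λ z → mu (replc 0 z (cmd (shiftName (suc c) b) (shiftN (suc c) t))))
             (shiftN-shiftN 0 c u z≤n))))
⟶-shiftN c (lamξ s) = lamξ (⟶-shiftN c s)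
⟶-shiftN c (appL s) = appL (⟶-shiftN c s)
⟶-shiftN c (appR s) = appR (⟶-shiftN c s)
⟶-shiftN c (muξ (cmdξ s)) = muξ (cmdξ (⟶-shiftN (suc c) s))

⟶-substV : ∀ k u {t t'} → t ⟶t t' → substV k u t ⟶t substV k u t'
⟶-substV k u (β {t} {w}) = cast⟶ β (sym (substV-substV 0 k u w t z≤n))
⟶-substV k u (μ {cmd b t} {w}) =
  cast⟶ μ
    (sym
       (trans (cong mu (substVc-replc k (shiftN 0 u) 0 (shiftN 0 w) b t (fnT-shiftN-self 0 u)))
          (cong (λ z → mu (replc 0 z (cmd b (substV k (shiftN 0 u) t))))
             (sym (shiftN-substV 0 k u w)))))
⟶-substV k u (lamξ s) = lamξ (⟶-substV (suc k) (shiftV 0 u) s)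
⟶-substV k u (appL s) = appL (⟶-substV k u s)
⟶-substV k u (appR s) = appR (⟶-substV k u s)
⟶-substV k u (muξ (cmdξ s)) = muξ (cmdξ (⟶-substV k (shiftN 0 u) s))

⟶-repl : ∀ k U {t t'} → t ⟶t t' → repl k U t ⟶t repl k U t'
⟶-replc : ∀ k U b {t t'} → t ⟶t t' → replc k U (cmd b t) ⟶c replc k U (cmd b t')
⟶-repl k U (β {t} {w}) = cast⟶ β (sym (repl-substV k U 0 w t))
⟶-repl k U (μ {cmd b t} {w}) =
  cast⟶ μ
    (sym
       (trans
          (cong mu (replc-repl 0 (suc k) (shiftN 0 U) (shiftN 0 w) b t (λ ()) (fnT-shiftN-self 0 U)))
          (cong (λ z → mu (replc 0 z (replc (suc k) (shiftN 0 U) (cmd b t))))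
             (sym (shiftN-repl-≤ 0 k U w z≤n)))))
⟶-repl k U (lamξ s) = lamξ (⟶-repl k (shiftV 0 U) s)
⟶-repl k U (appL s) = appL (⟶-repl k U s)
⟶-repl k U (appR s) = appR (⟶-repl k U s)
⟶-repl k U (muξ (cmdξ {b} s)) = muξ (⟶-replc (suc k) (shiftN 0 U) b s)
⟶-replc k U b s with b ≡ᵇ k
... | true = cmdξ (appL (⟶-repl k U s))
... | false = cmdξ (⟶-repl k U s)

infix 4 _⟶*[_]_
data _⟶*[_]_ : Term → ℕ → Term → Set where
  [] : ∀ {t} → t ⟶*[ 0 ] t
  _∷_ : ∀ {t t' t'' k} → t ⟶t t' → t' ⟶*[ k ] t'' → t ⟶*[ suc k ] t''

_++*_ : ∀ {a b c m n} → a ⟶*[ m ] b → b ⟶*[ n ] c → a ⟶*[ m + n ] c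
[] ++* q = q
(s ∷ p) ++* q = s ∷ (p ++* q)

map* : (f : Term → Term) → (∀ {a b} → a ⟶t b → f a ⟶t f b) →
       ∀ {a b n} → a ⟶*[ n ] b → f a ⟶*[ n ] f b
map* f g [] = []
map* f g (s ∷ p) = g s ∷ map* f g p

Steps : Term → ℕ → Set
Steps t k = Σ Term λ w → t ⟶*[ k ] w

steps0 : ∀ {t} → Steps t 0
steps0 {t} = t , []

steps-cast : ∀ {t k k'} → k ≡ k' → Steps t k → Steps t k'
steps-cast refl s = s

∨-≤ : ∀ a b {n1 n2} → (T a → 1 ≤ n1) → (T b → 1 ≤ n2) → T (a ∨ b) → 1 ≤ n1 + n2
∨-≤ true b {n1} {n2} f g x = ≤-trans (f x) (m≤m+n n1 n2)
∨-≤ false b {n1} {n2} f g x = ≤-trans (g x) (m≤n+m n2 n1)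

-- Replaying a step u ⟶ u' of the argument: t{k/u} reduces to t{k/u'},
-- in at least one step when k occurs in t (one step per occurrence).
substV-arg⟶ : ∀ {u u'} → u ⟶t u' → ∀ k t →
  Σ ℕ λ n → (substV k u t ⟶*[ n ] substV k u' t) × (T (fvT k t) → 1 ≤ n)
substV-arg⟶ {u} {u'} s k (var x) with x ≡ᵇ k
... | true = 1 , (s ∷ []) , (λ _ → s≤s z≤n)
... | false = 0 , [] , (λ ())
substV-arg⟶ s k (lam t) with substV-arg⟶ (⟶-shiftV 0 s) (suc k) t
... | n , p , f = n , map* lam lamξ p , f
substV-arg⟶ {u} {u'} s k (app t r) with substV-arg⟶ s k t | substV-arg⟶ s k r
... | n1 , p1 , f1 | n2 , p2 , f2 =
  n1 + n2 ,
  (map* (λ z → app z (substV k u r)) appL p1 ++* map* (app (substV k u' t)) appR p2) ,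
  ∨-≤ (fvT k t) (fvT k r) f1 f2
substV-arg⟶ s k (mu (cmd b t)) with substV-arg⟶ (⟶-shiftN 0 s) k t
... | n , p , f = n , map* (λ z → mu (cmd b z)) (λ x → muξ (cmdξ x)) p , f

-- The same for replacement: each occurrence [k]s becomes [k](s u), and the
-- step u ⟶ u' is replayed there.
repl-arg⟶ : ∀ {U U'} → U ⟶t U' → ∀ k t →
  Σ ℕ λ n → (repl k U t ⟶*[ n ] repl k U' t) × (T (fnT k t) → 1 ≤ n)
replc-arg⟶ : ∀ {U U'} → U ⟶t U' → ∀ k c →
  Σ ℕ λ n → (mu (replc k U c) ⟶*[ n ] mu (replc k U' c)) × (T (fnC k c) → 1 ≤ n)
repl-arg⟶ s k (var x) = 0 , [] , (λ ())
repl-arg⟶ s k (lam t) with repl-arg⟶ (⟶-shiftV 0 s) k t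
... | n , p , f = n , map* lam lamξ p , f
repl-arg⟶ {U} {U'} s k (app t r) with repl-arg⟶ s k t | repl-arg⟶ s k r
... | n1 , p1 , f1 | n2 , p2 , f2 =
  n1 + n2 ,
  (map* (λ z → app z (repl k U r)) appL p1 ++* map* (app (repl k U' t)) appR p2) ,
  ∨-≤ (fnT k t) (fnT k r) f1 f2
repl-arg⟶ s k (mu c) = replc-arg⟶ (⟶-shiftN 0 s) (suc k) c
replc-arg⟶ {U} {U'} s k (cmd b t) with b ≡ᵇ k
... | true with repl-arg⟶ s k t
... | n , p , f =
  n + 1 ,
  (map* (λ z → mu (cmd b (app z U))) (λ x → muξ (cmdξ (appL x))) p ++* (muξ (cmdξ (appR s)) ∷ [])) ,
  (λ _ → m≤n+m 1 n)
replc-arg⟶ {U} {U'} s k (cmd b t) | false with repl-arg⟶ s k t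
... | n , p , f = n , map* (λ z → mu (cmd b z)) (λ x → muξ (cmdξ x)) p , f

substV-arg⟶* : ∀ {u u' b} → u ⟶*[ b ] u' → ∀ k t →
  Σ ℕ λ n → (substV k u t ⟶*[ n ] substV k u' t) × (T (fvT k t) → b ≤ n)
substV-arg⟶* [] k t = 0 , [] , (λ _ → z≤n)
substV-arg⟶* (s ∷ p) k t with substV-arg⟶ s k t | substV-arg⟶* p k t
... | n1 , p1 , f1 | n2 , p2 , f2 = n1 + n2 , (p1 ++* p2) , (λ x → +-mono-≤ (f1 x) (f2 x))

replc-arg⟶* : ∀ {U U' b} → U ⟶*[ b ] U' → ∀ k c →
  Σ ℕ λ n → (mu (replc k U c) ⟶*[ n ] mu (replc k U' c)) × (T (fnC k c) → b ≤ n)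
replc-arg⟶* [] k c = 0 , [] , (λ _ → z≤n)
replc-arg⟶* (s ∷ p) k c with replc-arg⟶ s k c | replc-arg⟶* p k c
... | n1 , p1 , f1 | n2 , p2 , f2 = n1 + n2 , (p1 ++* p2) , (λ x → +-mono-≤ (f1 x) (f2 x))

⟶*-shiftN : ∀ {u u' b} → u ⟶*[ b ] u' → shiftN 0 u ⟶*[ b ] shiftN 0 u'
⟶*-shiftN = map* (shiftN 0) (⟶-shiftN 0)

lam-steps : ∀ {t h' a} → lam t ⟶*[ a ] h' → Σ Term λ t' → (h' ≡ lam t') × (t ⟶*[ a ] t')
lam-steps [] = _ , refl , []
lam-steps (lamξ s ∷ p) with lam-steps p
... | t' , e , q = t' , e , (s ∷ q)

mu-steps : ∀ {c h' a} → mu c ⟶*[ a ] h' → ∀ k U →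
  Σ Cmd λ c' → (h' ≡ mu c') × (mu (replc k U c) ⟶*[ a ] mu (replc k U c'))
mu-steps [] k U = _ , refl , []
mu-steps (muξ (cmdξ {b} s) ∷ p) k U with mu-steps p k U
... | c' , e , q = c' , e , (muξ (⟶-replc k U b s) ∷ q)

head-cong : ∀ vs {a a'} → a ⟶t a' → (a ·· vs) ⟶t (a' ·· vs)
head-cong [] s = s
head-cong (v ∷ vs) s = head-cong vs (appL s)

head-cong* : ∀ vs {a a' n} → a ⟶*[ n ] a' → (a ·· vs) ⟶*[ n ] (a' ·· vs)
head-cong* vs = map* (_·· vs) (head-cong vs)

infix 4 _⟶ₗ_
data _⟶ₗ_ : List Term → List Term → Set where
  here : ∀ {v v' vs} → v ⟶t v' → (v ∷ vs) ⟶ₗ (v' ∷ vs)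
  there : ∀ {v vs vs'} → vs ⟶ₗ vs' → (v ∷ vs) ⟶ₗ (v ∷ vs')

data _⟶ₗ*[_]_ : List Term → ℕ → List Term → Set where
  [] : ∀ {vs} → vs ⟶ₗ*[ 0 ] vs
  _∷_ : ∀ {vs vs' vs'' k} → vs ⟶ₗ vs' → vs' ⟶ₗ*[ k ] vs'' → vs ⟶ₗ*[ suc k ] vs''

args-cong : ∀ {vs vs'} h → vs ⟶ₗ vs' → (h ·· vs) ⟶t (h ·· vs')
args-cong h (here {vs = vs} s) = head-cong vs (appR s)
args-cong h (there {v = v} l) = args-cong (app h v) l

args-cong* : ∀ {vs vs' n} h → vs ⟶ₗ*[ n ] vs' → (h ·· vs) ⟶*[ n ] (h ·· vs')
args-cong* h [] = []
args-cong* h (l ∷ p) = args-cong h l ∷ args-cong* h p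

-- Heads h (variables and applications) for which h v is never a redex.
data Rigid : Term → Set where
  rvar : ∀ {x} → Rigid (var x)
  rapp : ∀ {a b} → Rigid (app a b)

spine-step : ∀ {h} → Rigid h → ∀ vs {w} → (h ·· vs) ⟶t w →
  (Σ Term λ h' → (h ⟶t h') × (w ≡ h' ·· vs)) ⊎
  (Σ (List Term) λ vs' → (vs ⟶ₗ vs') × (w ≡ h ·· vs'))
spine-step rh [] s = inj₁ (_ , s , refl)
spine-step rh (v ∷ vs) s with spine-step rapp vs s
spine-step rvar (v ∷ vs) s | inj₁ (_ , appL () , e)
spine-step rvar (v ∷ vs) s | inj₁ (_ , appR r , e) = inj₂ (_ , here r , e)
spine-step rapp (v ∷ vs) s | inj₁ (_ , appL r , e) = inj₁ (_ , r , e)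
spine-step rapp (v ∷ vs) s | inj₁ (_ , appR r , e) = inj₂ (_ , here r , e)
spine-step rh (v ∷ vs) s | inj₂ (vs' , l , e) = inj₂ (_ , there l , e)

data Contracts : Term → Term → Term → Set where
  hβ : ∀ {t u} → Contracts (lam t) u (substV 0 u t)
  hμ : ∀ {c u} → Contracts (mu c) u (mu (replc 0 (shiftN 0 u) c))

data Decomp (h u : Term) (vs : List Term) (k : ℕ) : Set where
  noHead : ∀ {h' u' vs' a b c} →
    h ⟶*[ a ] h' → u ⟶*[ b ] u' → vs ⟶ₗ*[ c ] vs' →
    k ≡ a + b + c → Decomp h u vs k
  withHead : ∀ {h' u' vs' a b c w r} →
    h ⟶*[ a ] h' → u ⟶*[ b ] u' → vs ⟶ₗ*[ c ] vs' →
    Contracts h' u' w → Steps (w ·· vs') r →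
    k ≡ a + b + c + suc r → Decomp h u vs k

+-suc-middle : ∀ a b c → suc (a + b + c) ≡ a + suc b + c
+-suc-middle = solve-∀

+-suc-right : ∀ a b c → suc (a + b + c) ≡ a + b + suc c
+-suc-right = solve-∀

push-head : ∀ {h h1 u vs k} → h ⟶t h1 → Decomp h1 u vs k → Decomp h u vs (suc k)
push-head r (noHead ha hb hc e) = noHead (r ∷ ha) hb hc (cong suc e)
push-head r (withHead ha hb hc hd sq e) = withHead (r ∷ ha) hb hc hd sq (cong suc e)

push-arg : ∀ {h u u1 vs k} → u ⟶t u1 → Decomp h u1 vs k → Decomp h u vs (suc k)
push-arg r (noHead {a = a} {b} {c} ha hb hc e) =
  noHead ha (r ∷ hb) hc (trans (cong suc e) (+-suc-middle a b c))
push-arg r (withHead {a = a} {b} {c} {r = r'} ha hb hc hd sq e) =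
  withHead ha (r ∷ hb) hc hd sq (trans (cong suc e) (cong (_+ suc r') (+-suc-middle a b c)))

push-args : ∀ {h u vs vs1 k} → vs ⟶ₗ vs1 → Decomp h u vs1 k → Decomp h u vs (suc k)
push-args r (noHead {a = a} {b} {c} ha hb hc e) =
  noHead ha hb (r ∷ hc) (trans (cong suc e) (+-suc-right a b c))
push-args r (withHead {a = a} {b} {c} {r = r'} ha hb hc hd sq e) =
  withHead ha hb (r ∷ hc) hd sq (trans (cong suc e) (cong (_+ suc r') (+-suc-right a b c)))

-- Every reduction sequence from h u v₁ ⋯ vₘ decomposes as above: as long as
-- the head redex is not contracted, h u is rigid and steps stay in h, u or vᵢ.
decomp : ∀ {h u vs k w} → (app h u ·· vs) ⟶*[ k ] w → Decomp h u vs k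
decomp [] = noHead [] [] [] refl
decomp {h} {u} {vs} (s ∷ rest) with spine-step rapp vs s
... | inj₁ (_ , β , refl) = withHead [] [] [] hβ (_ , rest) refl
... | inj₁ (_ , μ , refl) = withHead [] [] [] hμ (_ , rest) refl
... | inj₁ (_ , appL r , refl) = push-head r (decomp rest)
... | inj₁ (_ , appR r , refl) = push-arg r (decomp rest)
... | inj₂ (_ , l , refl) = push-args l (decomp rest)

replay-β : ∀ {t h' u u' vs vs' a b c} →
  lam t ⟶*[ a ] h' → u ⟶*[ b ] u' → vs ⟶ₗ*[ c ] vs' →
  Σ Term λ t' → (h' ≡ lam t') × Σ ℕ λ n →
    ((substV 0 u t ·· vs) ⟶*[ n + (a + c) ] (substV 0 u' t' ·· vs')) ×
    (0 ∈fv t → b ≤ n)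
replay-β {t} {u' = u'} {vs} ha hb hc with lam-steps ha | substV-arg⟶* hb 0 t
... | t' , refl , ta | n , argReplay , copies =
  t' , refl , n ,
  (head-cong* vs argReplay ++*
   (head-cong* vs (map* (substV 0 u') (⟶-substV 0 u') ta) ++*
    args-cong* (substV 0 u' t') hc)) ,
  copies

replay-μ : ∀ {c h' u u' vs vs' a b d} →
  mu c ⟶*[ a ] h' → u ⟶*[ b ] u' → vs ⟶ₗ*[ d ] vs' →
  Σ Cmd λ c' → (h' ≡ mu c') × Σ ℕ λ n →
    ((mu (replc 0 (shiftN 0 u) c) ·· vs) ⟶*[ n + (a + d) ]
     (mu (replc 0 (shiftN 0 u') c') ·· vs')) ×
    (0 ∈fn c → b ≤ n)
replay-μ {c} {u' = u'} {vs} ha hb hc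
  with mu-steps ha 0 (shiftN 0 u') | replc-arg⟶* (⟶*-shiftN hb) 0 c
... | c' , refl , ma | n , argReplay , copies =
  c' , refl , n ,
  (head-cong* vs argReplay ++*
   (head-cong* vs ma ++* args-cong* (mu (replc 0 (shiftN 0 u') c')) hc)) ,
  copies

-- What the analysis of a reduction sequence of length k from a redex-headed
-- term r (contracting to w, with argument u) yields: the sequence spends
-- argLen steps in u and restLen steps elsewhere (plus at most one contraction),
-- and w has a sequence of length copyLen + restLen, where copyLen ≥ argLen
-- whenever the bound symbol occurs (condition Occurs).
record RedexBound (u w : Term) (Occurs : Set) (k : ℕ) : Set where
  constructor mkRedexBound
  field
    argLen   : ℕ
    restLen  : ℕ
    copyLen  : ℕ
    argRed   : Steps u argLen
    contrRed : Steps w (copyLen + restLen)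
    copies   : Occurs → argLen ≤ copyLen
    bound    : k ≤ argLen + restLen + 1

bound-noHead : ∀ {k} a b c → k ≡ a + b + c → k ≤ b + (a + c) + 1
bound-noHead a b c refl = ≤-trans (m≤m+n (a + b + c) 1) (≤-reflexive (rearrange a b c))
  where
  rearrange : ∀ a b c → a + b + c + 1 ≡ b + (a + c) + 1
  rearrange = solve-∀

bound-withHead : ∀ {k} a b c r → k ≡ a + b + c + suc r → k ≤ b + (a + c + r) + 1
bound-withHead a b c r refl = ≤-reflexive (rearrange a b c r)
  where
  rearrange : ∀ a b c r → a + b + c + suc r ≡ b + (a + c + r) + 1
  rearrange = solve-∀

analyse-β : ∀ t u vs k → Steps (app (lam t) u ·· vs) k →
  RedexBound u (substV 0 u t ·· vs) (0 ∈fv t) k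
analyse-β t u vs k (_ , red) with decomp {lam t} {u} {vs} red
... | noHead {a = a} {b} {c} ha hb hc len with replay-β ha hb hc
...   | _ , refl , n , replay , copies =
  mkRedexBound b (a + c) n (_ , hb) (_ , replay) copies (bound-noHead a b c len)
analyse-β t u vs k (_ , red)
  | withHead {a = a} {b} {c} {r = r} ha hb hc contr (_ , rest) len
  with replay-β ha hb hc | contr
...   | _ , refl , n , replay , copies | hβ =
  mkRedexBound b (a + c + r) n (_ , hb) (steps-cast (+-assoc n (a + c) r) (_ , (replay ++* rest)))
    copies (bound-withHead a b c r len)

analyse-μ : ∀ c u vs k → Steps (app (mu c) u ·· vs) k →
  RedexBound u (mu (replc 0 (shiftN 0 u) c) ·· vs) (0 ∈fn c) k
analyse-μ c u vs k (_ , red) with decomp {mu c} {u} {vs} red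
... | noHead {a = a} {b} {d} ha hb hc len with replay-μ ha hb hc
...   | _ , refl , n , replay , copies =
  mkRedexBound b (a + d) n (_ , hb) (_ , replay) copies (bound-noHead a b d len)
analyse-μ c u vs k (_ , red)
  | withHead {a = a} {b} {d} {r = r} ha hb hc contr (_ , rest) len
  with replay-μ ha hb hc | contr
...   | _ , refl , n , replay , copies | hμ =
  mkRedexBound b (a + d + r) n (_ , hb) (steps-cast (+-assoc n (a + d) r) (_ , (replay ++* rest)))
    copies (bound-withHead a b d r len)

IsSup-cong : ∀ {P Q : ℕ → Set} {e} → (∀ k → P k → Q k) → (∀ k → Q k → P k) →
  IsSup P e → IsSup Q e
IsSup-cong {e = fin n} f g (b , l) =
  (λ k q → b k (g k q)) , (λ m bm → l m (λ k p → bm k (f k p)))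
IsSup-cong {e = ∞} f g s = λ m bm → s m (λ k p → bm k (f k p))

IsSup-attained : ∀ {P : ℕ → Set} {n} → P 0 → IsSup P (fin n) → ¬ ¬ P n
IsSup-attained {n = zero} p0 s np = np p0
IsSup-attained {P} {n = suc m} p0 (bnd , least) np = 1+n≰n (least m below-n)
  where
  below-n : ∀ k → P k → k ≤ m
  below-n k p = ≤-pred (≤∧≢⇒< (bnd k p) (λ e → np (subst P e p)))

IsSup-fin : ∀ {P : ℕ → Set} {n} → (∀ k → P k → k ≤ n) → ¬ ¬ P n → IsSup P (fin n)
IsSup-fin {P} {n} b nnp = b , least
  where
  least : ∀ m → (∀ k → P k → k ≤ m) → n ≤ m
  least m bm with n ≤? m
  ... | yes p = p
  ... | no np = ⊥-elim (nnp (λ p → np (bm n p)))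

IsSup-sum : ∀ {P₁ P₂ Q : ℕ → Set} (d : ℕ) {e₁ e₂} → P₁ 0 → P₂ 0
  → (∀ k → Q k → Σ ℕ λ k₁ → Σ ℕ λ k₂ → P₁ k₁ × P₂ k₂ × k ≤ k₁ + k₂ + d)
  → (∀ k₁ k₂ → P₁ k₁ → P₂ k₂ → Q (k₁ + k₂ + d))
  → IsSup P₁ e₁ → IsSup P₂ e₂ → IsSup Q ((e₁ +∞ e₂) +∞ fin d)
IsSup-sum d {∞} p₁0 p₂0 up lo s₁ s₂ =
  λ m bnd → s₁ m λ k p →
    ≤-trans (≤-trans (m≤m+n k 0) (m≤m+n (k + 0) d)) (bnd _ (lo k 0 p p₂0))
IsSup-sum d {fin n₁} {∞} p₁0 p₂0 up lo s₁ s₂ =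
  λ m bnd → s₂ m λ k p → ≤-trans (m≤m+n k d) (bnd _ (lo 0 k p₁0 p))
IsSup-sum {Q = Q} d {fin n₁} {fin n₂} p₁0 p₂0 up lo s₁ s₂ =
  IsSup-fin bounded
    (λ nq → IsSup-attained p₁0 s₁ λ p₁ →
            IsSup-attained p₂0 s₂ λ p₂ → nq (lo n₁ n₂ p₁ p₂))
  where
  bounded : ∀ k → Q k → k ≤ n₁ + n₂ + d
  bounded k q with up k q
  ... | k₁ , k₂ , p₁ , p₂ , le =
    ≤-trans le (+-monoˡ-≤ d (+-mono-≤ (proj₁ s₁ k₁ p₁) (proj₁ s₂ k₂ p₂)))

IsSup-+0 : ∀ {P : ℕ → Set} e → IsSup P (e +∞ fin 0) → IsSup P e
IsSup-+0 {P} (fin n) s = subst (λ z → IsSup P (fin z)) (+-identityʳ n) s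
IsSup-+0 ∞ s = s

IsSup-0+ : ∀ {P : ℕ → Set} e d → IsSup P ((fin 0 +∞ e) +∞ fin d) → IsSup P (e +∞ fin d)
IsSup-0+ (fin n) d s = s
IsSup-0+ ∞ d s = s

IsSup-zero : IsSup (_≡ 0) (fin 0)
IsSup-zero = (λ { k refl → z≤n }) , (λ m _ → z≤n)

-- Redex whose argument is used (the bound symbol occurs): every reduction
-- of r is dominated by one of the contractum plus the contraction step.
IsSup-used-redex : ∀ {r u w : Term} {Occurs : Set} {e} → Occurs → r ⟶t w →
  (∀ k → Steps r k → RedexBound u w Occurs k) →
  IsSup (Steps w) e → IsSup (Steps r) (e +∞ fin 1)
IsSup-used-redex {r} {u} {w} {e = e} occurs contract analyse sup =
  IsSup-0+ e 1 (IsSup-sum 1 refl steps0 upper lower IsSup-zero sup)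
  where
  upper : ∀ k → Steps r k → Σ ℕ λ k₁ → Σ ℕ λ k₂ → k₁ ≡ 0 × Steps w k₂ × k ≤ k₁ + k₂ + 1
  upper k red = 0 , copyLen + restLen , refl , contrRed ,
                ≤-trans bound (+-monoˡ-≤ 1 (+-monoˡ-≤ restLen (copies occurs)))
    where open RedexBound (analyse k red)
  lower : ∀ k₁ k₂ → k₁ ≡ 0 → Steps w k₂ → Steps r (k₁ + k₂ + 1)
  lower .0 k₂ refl (w' , red) = steps-cast (+-comm 1 k₂) (w' , (contract ∷ red))

-- Redex whose argument is discarded: reductions of the argument and of the
-- contractum are independent, so their lengths add up.
IsSup-discarded-redex : ∀ {r u w : Term} {Occurs : Set} {e₁ e₂} →
  (∀ {k u'} → u ⟶*[ k ] u' → Σ Term λ r' → (r ⟶*[ k ] r') × (r' ⟶t w)) →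
  (∀ k → Steps r k → RedexBound u w Occurs k) →
  IsSup (Steps u) e₁ → IsSup (Steps w) e₂ → IsSup (Steps r) ((e₁ +∞ e₂) +∞ fin 1)
IsSup-discarded-redex {r} {u} {w} reduceArg analyse = IsSup-sum 1 steps0 steps0 upper lower
  where
  upper : ∀ k → Steps r k →
    Σ ℕ λ k₁ → Σ ℕ λ k₂ → Steps u k₁ × Steps w k₂ × k ≤ k₁ + k₂ + 1
  upper k red = argLen , copyLen + restLen , argRed , contrRed ,
                ≤-trans bound (+-monoˡ-≤ 1 (+-monoʳ-≤ argLen (m≤n+m restLen copyLen)))
    where open RedexBound (analyse k red)
  lower : ∀ k₁ k₂ → Steps u k₁ → Steps w k₂ → Steps r (k₁ + k₂ + 1)
  lower k₁ k₂ (_ , argRed) (w' , red) with reduceArg argRed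
  ... | _ , toRedex , contract =
    steps-cast (trans (+-suc k₁ k₂) (+-comm 1 (k₁ + k₂)))
               (w' , (toRedex ++* (contract ∷ red)))

obj→steps : ∀ {t k o} → term t ⟶[ k ] o → Steps t k
obj→steps done = steps0
obj→steps (step (tstep s) rest) with obj→steps rest
... | w , q = w , (s ∷ q)

steps→obj : ∀ {t k w} → t ⟶*[ k ] w → term t ⟶[ k ] term w
steps→obj [] = done
steps→obj (s ∷ p) = step (tstep s) (steps→obj p)

η⇒IsSup : ∀ {t e} → η term t ≡ e → IsSup (Steps t) e
η⇒IsSup = IsSup-cong (λ k p → obj→steps (proj₂ p))
                     (λ k p → term (proj₁ p) , steps→obj (proj₂ p))

IsSup⇒η : ∀ {t e} → IsSup (Steps t) e → η term t ≡ e
IsSup⇒η = IsSup-cong (λ k p → term (proj₁ p) , steps→obj (proj₂ p))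
                     (λ k p → obj→steps (proj₂ p))

-- Item (1).  `ArgSteps ts k`: k splits as a sum of reduction lengths of
-- the terms of ts; these are exactly the reduction lengths of x ts.
ArgSteps : List Term → ℕ → Set
ArgSteps [] k = k ≡ 0
ArgSteps (t ∷ ts) k = Σ ℕ λ k₁ → Σ ℕ λ k₂ → Steps t k₁ × ArgSteps ts k₂ × k ≡ k₁ + k₂

argSteps0 : ∀ ts → ArgSteps ts 0
argSteps0 [] = refl
argSteps0 (t ∷ ts) = 0 , 0 , steps0 , argSteps0 ts , refl

argSteps-step : ∀ {ts ts' k} → ts ⟶ₗ ts' → ArgSteps ts' k → ArgSteps ts (suc k)
argSteps-step (here s) (k₁ , k₂ , (w , p) , q , e) =
  suc k₁ , k₂ , (w , (s ∷ p)) , q , cong suc e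
argSteps-step (there l) (k₁ , k₂ , p , q , e) =
  k₁ , suc k₂ , p , argSteps-step l q , trans (cong suc e) (sym (+-suc k₁ k₂))

argSteps-var : ∀ {x ts k w} → (var x ·· ts) ⟶*[ k ] w → ArgSteps ts k
argSteps-var {ts = ts} [] = argSteps0 ts
argSteps-var {x} {ts} (s ∷ rest) with spine-step (rvar {x}) ts s
... | inj₁ (_ , () , _)
... | inj₂ (_ , l , refl) = argSteps-step l (argSteps-var rest)

argSteps-spine : ∀ h ts k → ArgSteps ts k → Steps (h ·· ts) k
argSteps-spine h [] .0 refl = steps0
argSteps-spine h (t ∷ ts) .(k₁ + k₂) (k₁ , k₂ , (t' , s) , q , refl)
  with argSteps-spine (app h t') ts k₂ q
... | w , p = w , (head-cong* ts (map* (app h) appR s) ++* p)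

IsSup-args : ∀ {ts es} → ηAll ts es → IsSup (ArgSteps ts) (sum∞ es)
IsSup-args [] = IsSup-zero
IsSup-args {t ∷ ts} {e ∷ es} (h ∷ hs) =
  IsSup-+0 (e +∞ sum∞ es)
    (IsSup-sum 0 steps0 (argSteps0 ts) upper lower (η⇒IsSup h) (IsSup-args hs))
  where
  upper : ∀ k → ArgSteps (t ∷ ts) k →
    Σ ℕ λ k₁ → Σ ℕ λ k₂ → Steps t k₁ × ArgSteps ts k₂ × k ≤ k₁ + k₂ + 0
  upper k (k₁ , k₂ , s , q , e) = k₁ , k₂ , s , q , ≤-reflexive (trans e (sym (+-identityʳ _)))
  lower : ∀ k₁ k₂ → Steps t k₁ → ArgSteps ts k₂ → ArgSteps (t ∷ ts) (k₁ + k₂ + 0)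
  lower k₁ k₂ s q = k₁ , k₂ , s , q , +-identityʳ _

η-var-spine : ∀ (x : ℕ) (ts : List Term) (es : List ℕ∞) →
  ηAll ts es → η term (var x ·· ts) ≡ sum∞ es
η-var-spine x ts es h =
  IsSup⇒η (IsSup-cong (argSteps-spine (var x) ts) (λ k p → argSteps-var (proj₂ p))
                      (IsSup-args h))

-- Items (2)–(4): reductions of λx.t, μα.c and [α]t are those of t, c and t.
η-lam : ∀ (t : Term) (e : ℕ∞) → η term t ≡ e → η term (lam t) ≡ e
η-lam t e h = IsSup⇒η (IsSup-cong under-lam from-lam (η⇒IsSup h))
  where
  under-lam : ∀ k → Steps t k → Steps (lam t) k
  under-lam k (_ , red) = _ , map* lam lamξ red
  from-lam : ∀ k → Steps (lam t) k → Steps t k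
  from-lam k (_ , red) with lam-steps red
  ... | t' , _ , red' = t' , red'

com→mu : ∀ {c k o} → com c ⟶[ k ] o → Steps (mu c) k
com→mu done = steps0
com→mu (step (cstep s) rest) with com→mu rest
... | w , q = w , (muξ s ∷ q)

mu→com : ∀ {c k w} → mu c ⟶*[ k ] w → Σ Obj λ o → com c ⟶[ k ] o
mu→com [] = _ , done
mu→com (muξ s ∷ p) with mu→com p
... | o , q = o , step (cstep s) q

η-mu : ∀ (c : Cmd) (e : ℕ∞) → η com c ≡ e → η term (mu c) ≡ e
η-mu c e h = IsSup⇒η (IsSup-cong (λ k p → com→mu (proj₂ p)) (λ k p → mu→com (proj₂ p)) h)

cmd→steps : ∀ {α t k o} → com (cmd α t) ⟶[ k ] o → Steps t k
cmd→steps done = steps0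
cmd→steps (step (cstep (cmdξ s)) rest) with cmd→steps rest
... | w , q = w , (s ∷ q)

steps→cmd : ∀ {α t k w} → t ⟶*[ k ] w → com (cmd α t) ⟶[ k ] com (cmd α w)
steps→cmd [] = done
steps→cmd (s ∷ p) = step (cstep (cmdξ s)) (steps→cmd p)

η-cmd : ∀ (α : ℕ) (t : Term) (e : ℕ∞) → η term t ≡ e → η com (cmd α t) ≡ e
η-cmd α t e h =
  IsSup-cong (λ k p → com (cmd α (proj₁ p)) , steps→cmd (proj₂ p))
    (λ k p → cmd→steps (proj₂ p))
    (η⇒IsSup h)

¬T⇒false : ∀ {b} → ¬ T b → b ≡ false
¬T⇒false {true} f = ⊥-elim (f _)
¬T⇒false {false} f = refl

η-used-β : ∀ (t u : Term) (vs : List Term) (e : ℕ∞) → 0 ∈fv t →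
  η term (substV 0 u t ·· vs) ≡ e → η term (app (lam t) u ·· vs) ≡ (e +∞ fin 1)
η-used-β t u vs e occurs h =
  IsSup⇒η (IsSup-used-redex occurs (head-cong vs β) (analyse-β t u vs) (η⇒IsSup h))

η-discarded-β : ∀ (t u : Term) (vs : List Term) (e₁ e₂ : ℕ∞) → ¬ (0 ∈fv t) →
  η term u ≡ e₁ → η term (substV 0 u t ·· vs) ≡ e₂ →
  η term (app (lam t) u ·· vs) ≡ ((e₁ +∞ e₂) +∞ fin 1)
η-discarded-β t u vs e₁ e₂ fresh h₁ h₂ =
  IsSup⇒η (IsSup-discarded-redex reduceArg (analyse-β t u vs) (η⇒IsSup h₁) (η⇒IsSup h₂))
  where
  reduceArg : ∀ {k u'} → u ⟶*[ k ] u' →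
    Σ Term λ r' → ((app (lam t) u ·· vs) ⟶*[ k ] r') × (r' ⟶t (substV 0 u t ·· vs))
  reduceArg {u' = u'} red =
    _ , head-cong* vs (map* (app (lam t)) appR red) ,
    subst (λ z → (app (lam t) u' ·· vs) ⟶t (z ·· vs))
          (substV-fresh 0 u' u t (¬T⇒false fresh)) (head-cong vs β)

η-used-μ : ∀ (c : Cmd) (u : Term) (vs : List Term) (e : ℕ∞) → 0 ∈fn c →
  η term (mu (replc 0 (shiftN 0 u) c) ·· vs) ≡ e → η term (app (mu c) u ·· vs) ≡ (e +∞ fin 1)
η-used-μ c u vs e occurs h =
  IsSup⇒η (IsSup-used-redex occurs (head-cong vs μ) (analyse-μ c u vs) (η⇒IsSup h))

η-discarded-μ : ∀ (c : Cmd) (u : Term) (vs : List Term) (e₁ e₂ : ℕ∞) → ¬ (0 ∈fn c) →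
  η term u ≡ e₁ → η term (mu c ·· vs) ≡ e₂ →
  η term (app (mu c) u ·· vs) ≡ ((e₁ +∞ e₂) +∞ fin 1)
η-discarded-μ c u vs e₁ e₂ fresh h₁ h₂ =
  IsSup⇒η (IsSup-discarded-redex reduceArg analyse (η⇒IsSup h₁) (η⇒IsSup h₂))
  where
  -- replacing an absent name is the identity, so the μ-step erases u
  unchanged : ∀ u' → replc 0 (shiftN 0 u') c ≡ c
  unchanged u' = replc-fresh 0 (shiftN 0 u') c (¬T⇒false fresh)
  analyse : ∀ k → Steps (app (mu c) u ·· vs) k → RedexBound u (mu c ·· vs) (0 ∈fn c) k
  analyse k red =
    subst (λ z → RedexBound u (mu z ·· vs) (0 ∈fn c) k) (unchanged u) (analyse-μ c u vs k red)
  reduceArg : ∀ {k u'} → u ⟶*[ k ] u' →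
    Σ Term λ r' → ((app (mu c) u ·· vs) ⟶*[ k ] r') × (r' ⟶t (mu c ·· vs))
  reduceArg {u' = u'} red =
    _ , head-cong* vs (map* (app (mu c)) appR red) ,
    subst (λ z → (app (mu c) u' ·· vs) ⟶t (mu z ·· vs)) (unchanged u') (head-cong vs μ)

lemma6p1 :
      (∀ (x : ℕ) (ts : List Term) (es : List ℕ∞) →
         ηAll ts es → η term (var x ·· ts) ≡ sum∞ es)
    × (∀ (t : Term) (e : ℕ∞) → η term t ≡ e → η term (lam t) ≡ e)
    × (∀ (c : Cmd) (e : ℕ∞) → η com c ≡ e → η term (mu c) ≡ e)
    × (∀ (α : ℕ) (t : Term) (e : ℕ∞) → η term t ≡ e → η com (cmd α t) ≡ e)
    × (∀ (t u : Term) (vs : List Term) (e : ℕ∞) → 0 ∈fv t →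
         η term (substV 0 u t ·· vs) ≡ e →
         η term (app (lam t) u ·· vs) ≡ (e +∞ fin 1))
    × (∀ (t u : Term) (vs : List Term) (e₁ e₂ : ℕ∞) → ¬ (0 ∈fv t) →
         η term u ≡ e₁ → η term (substV 0 u t ·· vs) ≡ e₂ →
         η term (app (lam t) u ·· vs) ≡ ((e₁ +∞ e₂) +∞ fin 1))
    × (∀ (c : Cmd) (u : Term) (vs : List Term) (e : ℕ∞) → 0 ∈fn c →
         η term (mu (replc 0 (shiftN 0 u) c) ·· vs) ≡ e →
         η term (app (mu c) u ·· vs) ≡ (e +∞ fin 1))
    × (∀ (c : Cmd) (u : Term) (vs : List Term) (e₁ e₂ : ℕ∞) → ¬ (0 ∈fn c) →
         η term u ≡ e₁ → η term (mu c ·· vs) ≡ e₂ →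
         η term (app (mu c) u ·· vs) ≡ ((e₁ +∞ e₂) +∞ fin 1))
lemma6p1 =
  η-var-spine , η-lam , η-mu , η-cmd ,
  η-used-β , η-discarded-β , η-used-μ , η-discarded-μ
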